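{- Let $G_2$ be the graph with vertices $v_1,\dots,v_6$ and edges $a_1=v_2v_6$, $a_2=v_2v_4$, $a_3=v_4v_6$, $a_4=v_1v_3$, $a_5=v_3v_5$, $a_6=v_1v_5$, $a_7=v_2v_5$, $a_8=v_1v_4$, $a_9=v_3v_6$. Then $$F^{G_2}(\mathbf{x},y)=\frac{1}{(1-yx_1x_5x_8)(1-yx_2x_6x_9)(1-yx_3x_4x_7)(1-yx_7x_8x_9)}+\frac{y^2x_1x_2x_3x_4x_5x_6}{(1-yx_1x_5x_8)(1-yx_2x_6x_9)(1-yx_3x_4x_7)(1-y^2x_1x_2x_3x_4x_5x_6)},$$ and consequently $F^{G_2}(y)=\frac{1+y+y^2}{(1-y)^3(1-y^2)}$.
   Context: For a finite graph $G$ with edges $a_1,\dots,a_n$, a magic labelling is a vector ${\alpha}=(\alpha_1,\dots,\alpha_n)\in\mathbb{N}^n$ ($\alpha_k$ the label of edge $a_k$, $\mathbb{N}=\{0,1,2,\dots\}$) such that for every vertex the sum of labels of incident edges equals a common number $s({\alpha})$, the magic sum. $S(G)$ is the set of magic labellings. $F^G(\mathbf{x},y)=\sum_{{\alpha}\in S(G)}x_1^{\alpha_1}\cdots x_n^{\alpha_n}y^{s({\alpha})}$ and $F^G(y)=F^G(1,\dots,1,y)=\sum_{s\ge0}h_G(s)y^s$, where $h_G(s)$ is the number of magic labellings with magic sum $s$. -}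

module Defs where

open import Data.Nat using (ℕ; zero; suc; _+_; _*_; _∸_; _≤ᵇ_; _≡ᵇ_)
open import Data.Bool using (Bool; true; false; _∧_; if_then_else_)
open import Data.Fin using (Fin; zero; suc)
open import Data.Product using (_×_; _,_; proj₁; proj₂)
open import Data.List using (List; []; _∷_; map; concatMap; upTo; allFin)
import Data.Nat.ListAction as NL
import Data.List as L
open import Data.Vec using (Vec; []; _∷_; lookup; zipWith; init; last)
import Data.Vec as V
open import Relation.Binary.PropositionalEquality using (_≡_)

-- Formal power series with ℕ coefficients in n commuting variables.
-- A monomial z₁^{m₁}⋯zₙ^{mₙ} is its exponent vector m : Vec ℕ n; a
-- series is its coefficient function  m ↦ [z^m] f.

Ser : ℕ → Set
Ser n = Vec ℕ n → ℕ

_≋_ : ∀ {n} → Ser n → Ser n → Set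
f ≋ g = ∀ m → f m ≡ g m

infix 4 _≋_

_≤ᵥ_ : ∀ {n} → Vec ℕ n → Vec ℕ n → Bool
[] ≤ᵥ [] = true
(a ∷ as) ≤ᵥ (b ∷ bs) = (a ≤ᵇ b) ∧ (as ≤ᵥ bs)

_≡ᵥ_ : ∀ {n} → Vec ℕ n → Vec ℕ n → Bool
[] ≡ᵥ [] = true
(a ∷ as) ≡ᵥ (b ∷ bs) = (a ≡ᵇ b) ∧ (as ≡ᵥ bs)

deg : ∀ {n} → Vec ℕ n → ℕ
deg = V.sum

mono : ∀ {n} → Vec ℕ n → Ser n
mono β m = if β ≡ᵥ m then 1 else 0

one : ∀ {n} → Ser n
one = mono (V.replicate _ 0)

_⊕_ : ∀ {n} → Ser n → Ser n → Ser n
(f ⊕ g) m = f m + g m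

infixl 6 _⊕_

-- f / (1 - z^β) = f · Σ_{k≥0} z^{kβ}, for a nonconstant monomial z^β.
-- [z^m] of it is Σ_{k ≥ 0, kβ ≤ m} [z^{m - kβ}] f; since β ≠ 0 only
-- k ≤ deg m can contribute, so the sum is finite.
divOneMinus : ∀ {n} → Vec ℕ n → Ser n → Ser n
divOneMinus β f m =
  NL.sum (map (λ k → let kβ = V.map (k *_) β in
                    if kβ ≤ᵥ m then f (zipWith _∸_ m kβ) else 0)
             (upTo (suc (deg m))))

-- The graph G₂: vertices v₁..v₆ (Fin 6, vᵢ ↦ i-1), edges a₁..a₉ (Fin 9).

edgeG₂ : Fin 9 → Fin 6 × Fin 6
edgeG₂ = lookup
  ( (i1 , i5) ∷ (i1 , i3) ∷ (i3 , i5) ∷ (i0 , i2) ∷ (i2 , i4)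
  ∷ (i0 , i4) ∷ (i1 , i4) ∷ (i0 , i3) ∷ (i2 , i5) ∷ [])
  where
  i0 i1 i2 i3 i4 i5 : Fin 6
  i0 = zero
  i1 = suc zero
  i2 = suc (suc zero)
  i3 = suc (suc (suc zero))
  i4 = suc (suc (suc (suc zero)))
  i5 = suc (suc (suc (suc (suc zero))))

_≡ᶠ_ : ∀ {k} → Fin k → Fin k → Bool
zero ≡ᶠ zero = true
suc i ≡ᶠ suc j = i ≡ᶠ j
_ ≡ᶠ _ = false

incident : Fin 6 → Fin 9 → Bool
incident v e = (v ≡ᶠ proj₁ (edgeG₂ e)) Data.Bool.∨ (v ≡ᶠ proj₂ (edgeG₂ e))

vertexSum : Vec ℕ 9 → Fin 6 → ℕ
vertexSum α v = NL.sum (map (λ e → if incident v e then lookup α e else 0) (allFin 9))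

isMagicWithSum : Vec ℕ 9 → ℕ → Bool
isMagicWithSum α s = L.foldr (λ v b → (vertexSum α v ≡ᵇ s) ∧ b) true (allFin 6)

-- F^{G₂}(x,y) = Σ_{α ∈ S(G₂)} x^α y^{s(α)}, as a series in the 10
-- variables x₁,…,x₉,y (exponent vector (α₁,…,α₉,s)).
FG₂ : Ser 10
FG₂ m = if isMagicWithSum (init m) (last m) then 1 else 0

box : (n b : ℕ) → List (Vec ℕ n)
box zero b = [] ∷ []
box (suc n) b = concatMap (λ i → map (i ∷_) (box n b)) (upTo (suc b))

-- F^{G₂}(y) = F^{G₂}(1,…,1,y): coefficient of y^s is Σ_α [x^α y^s] F^{G₂}.
-- Only α with all labels ≤ s can contribute (every edge is incident to a
-- vertex whose label sum is s), so the sum over the box {0..s}^9 is exact.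
hG₂ : ℕ → ℕ
hG₂ s = NL.sum (map (λ α → FG₂ (V._∷ʳ_ α s)) (box 9 s))

FG₂y : Ser 1
FG₂y m = hG₂ (V.head m)

m158 m269 m347 m789 m123456 : Vec ℕ 10
m158    = 1 ∷ 0 ∷ 0 ∷ 0 ∷ 1 ∷ 0 ∷ 0 ∷ 1 ∷ 0 ∷ 1 ∷ []
m269    = 0 ∷ 1 ∷ 0 ∷ 0 ∷ 0 ∷ 1 ∷ 0 ∷ 0 ∷ 1 ∷ 1 ∷ []
m347    = 0 ∷ 0 ∷ 1 ∷ 1 ∷ 0 ∷ 0 ∷ 1 ∷ 0 ∷ 0 ∷ 1 ∷ []
m789    = 0 ∷ 0 ∷ 0 ∷ 0 ∷ 0 ∷ 0 ∷ 1 ∷ 1 ∷ 1 ∷ 1 ∷ []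
m123456 = 1 ∷ 1 ∷ 1 ∷ 1 ∷ 1 ∷ 1 ∷ 0 ∷ 0 ∷ 0 ∷ 2 ∷ []

y¹ y² : Vec ℕ 1
y¹ = 1 ∷ []
y² = 2 ∷ []

{-# OPTIONS --safe #-}
module Submission where

-- G₂ is the triangular prism: the triangles a₁a₂a₃ and a₄a₅a₆ joined by the rungs a₇, a₈, a₉.
-- Comparing the vertex sums on the two triangles shows that a magic labelling gives opposite
-- triangle edges equal labels (α₁ = α₅, α₂ = α₆, α₃ = α₄); it is then determined by α₁, α₂, α₃
-- and α₁ + α₂ + α₇ = α₂ + α₃ + α₈ = α₁ + α₃ + α₉ = s. If α₁ ≤ α₈ its exponent vector is
-- a β₁₅₈ + b β₂₆₉ + c β₃₄₇ + d β₇₈₉, otherwise a β₁₅₈ + b β₂₆₉ + c β₃₄₇ + (e + 1) β₁₂₃₄₅₆, where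
-- β is the exponent of the corresponding monomial of the theorem. Each generator has a coordinate
-- that the generators inside it lack, so these representations are unique and the two kinds never
-- meet: both summands have 0/1 coefficients, with disjoint supports covering exactly the magic
-- labellings. Setting x = 1 turns 1/(1 − x^β y^k) into 1/(1 − y^k), because no x-exponent of a
-- generator exceeds its y-exponent, and 1/(1 − y) = (1 + y)/(1 − y²) finishes the computation.

open import Data.Bool using (true; false; _∧_; if_then_else_)
open import Data.Bool.Properties using (T-≡; ∧-conicalˡ; ∧-conicalʳ; ∧-identityʳ; ∧-zeroʳ; ∧-assoc)
open import Data.Empty using (⊥-elim)
open import Function.Bundles using (Equivalence)
open import Data.Fin using (Fin; zero; suc; #_)
open import Data.List using (List; []; _∷_; _++_; map; concatMap; upTo; foldr; allFin)
import Data.List as L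
import Data.List.Properties as Listₚ
open import Data.List.Membership.Propositional.Properties using (∈-allFin)
import Data.List.Relation.Unary.All as ListAll
open import Data.List.Relation.Unary.All.Properties using (all⁺; all⁻)
open import Data.Nat using (ℕ; zero; suc; _+_; _*_; _∸_; _≤ᵇ_; _≡ᵇ_; _≤_; _<_; _≤?_; z≤n; s≤s; >-nonZero)
open import Data.Nat.DivMod using (_/_; _%_; m≡m%n+[m/n]*n; m%n<n)
open import Data.Nat.ListAction using (sum)
open import Data.Nat.ListAction.Properties using (sum-++)
open import Data.Nat.Properties
open import Algebra.Properties.CommutativeSemigroup +-commutativeSemigroup using (interchange)
open import Data.Nat.Tactic.RingSolver
open import Data.Product using (_×_; _,_; proj₁; proj₂; ∃-syntax)
open import Data.Sum using (_⊎_; inj₁; inj₂)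
open import Data.Vec using (Vec; []; _∷_; _∷ʳ_; lookup; zipWith; init; last; replicate)
import Data.Vec as V
import Data.Vec.Properties as Vecₚ
open import Data.Vec.Relation.Unary.All as All using (All; []; _∷_; all?)
open import Data.Vec.Relation.Unary.All.Properties using (map⁺)
open import Defs
open import Level using (0ℓ)
open import Relation.Binary.Bundles using (Setoid)
open import Relation.Binary.Definitions using (tri<; tri≈; tri>)
open import Relation.Binary.PropositionalEquality
import Relation.Binary.Reasoning.Setoid as SetoidReasoning
open import Relation.Nullary using (¬_; yes; no)
open import Relation.Nullary.Decidable using (Dec; decidable-stable; toWitness; _×-dec_)

private variable
  A B : Set
  n : ℕ

∧≡true⇒× : ∀ a b → a ∧ b ≡ true → a ≡ true × b ≡ true
∧≡true⇒× a b eq = ∧-conicalˡ a b eq , ∧-conicalʳ a b eq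

≤ᵇ≡true⇒≤ : ∀ m n → (m ≤ᵇ n) ≡ true → m ≤ n
≤ᵇ≡true⇒≤ m n eq = ≤ᵇ⇒≤ m n (Equivalence.from T-≡ eq)

≤⇒≤ᵇ≡true : ∀ {m n} → m ≤ n → (m ≤ᵇ n) ≡ true
≤⇒≤ᵇ≡true m≤n = Equivalence.to T-≡ (≤⇒≤ᵇ m≤n)

≰⇒≤ᵇ≡false : ∀ {m n} → ¬ m ≤ n → (m ≤ᵇ n) ≡ false
≰⇒≤ᵇ≡false {m} {n} m≰n with m ≤ᵇ n in eq
... | true  = ⊥-elim (m≰n (≤ᵇ≡true⇒≤ m n eq))
... | false = refl

≡ᵇ≡true⇒≡ : ∀ m n → (m ≡ᵇ n) ≡ true → m ≡ n
≡ᵇ≡true⇒≡ m n eq = ≡ᵇ⇒≡ m n (Equivalence.from T-≡ eq)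

≢⇒≡ᵇ≡false : ∀ {m n} → m ≢ n → (m ≡ᵇ n) ≡ false
≢⇒≡ᵇ≡false {m} {n} m≢n with m ≡ᵇ n in eq
... | true  = ⊥-elim (m≢n (≡ᵇ≡true⇒≡ m n eq))
... | false = refl

≡⇒≡ᵇ≡true : ∀ {m n} → m ≡ n → (m ≡ᵇ n) ≡ true
≡⇒≡ᵇ≡true {m} {n} m≡n = Equivalence.to T-≡ (≡⇒≡ᵇ m n m≡n)

≢0⇒≡0 : ∀ {k} → ¬ k ≢ 0 → k ≡ 0
≢0⇒≡0 {k} = decidable-stable (k ≟ 0)

sumOver : (A → ℕ) → List A → ℕ
sumOver f xs = sum (map f xs)

sumBelow : (ℕ → ℕ) → ℕ → ℕ
sumBelow g n = sumOver g (upTo n)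

sumOver-cong : {f g : A → ℕ} → (∀ x → f x ≡ g x) → ∀ xs → sumOver f xs ≡ sumOver g xs
sumOver-cong f≗g []       = refl
sumOver-cong f≗g (x ∷ xs) = cong₂ _+_ (f≗g x) (sumOver-cong f≗g xs)

sumOver-zero : {f : A → ℕ} → (∀ x → f x ≡ 0) → ∀ xs → sumOver f xs ≡ 0
sumOver-zero f≗0 []       = refl
sumOver-zero f≗0 (x ∷ xs) = cong₂ _+_ (f≗0 x) (sumOver-zero f≗0 xs)

sumOver-+ : (f g : A → ℕ) → ∀ xs → sumOver (λ x → f x + g x) xs ≡ sumOver f xs + sumOver g xs
sumOver-+ f g []       = refl
sumOver-+ f g (x ∷ xs) =
  trans (cong (f x + g x +_) (sumOver-+ f g xs)) (interchange (f x) (g x) _ _)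

sumOver-++ : (f : A → ℕ) (xs ys : List A) → sumOver f (xs ++ ys) ≡ sumOver f xs + sumOver f ys
sumOver-++ f xs ys = trans (cong sum (Listₚ.map-++ f xs ys)) (sum-++ (map f xs) (map f ys))

sumOver-map : (f : B → ℕ) (h : A → B) (xs : List A) → sumOver f (map h xs) ≡ sumOver (λ x → f (h x)) xs
sumOver-map f h xs = cong sum (sym (Listₚ.map-∘ xs))

sumOver-concatMap : (f : B → ℕ) (h : A → List B) (xs : List A) →
                    sumOver f (concatMap h xs) ≡ sumOver (λ x → sumOver f (h x)) xs
sumOver-concatMap f h []       = refl
sumOver-concatMap f h (x ∷ xs) =
  trans (sumOver-++ f (h x) (concatMap h xs)) (cong (sumOver f (h x) +_) (sumOver-concatMap f h xs))

sumBelow-suc : ∀ g n → sumBelow g (suc n) ≡ sumBelow g n + g n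
sumBelow-suc g n = begin
  sumOver g (upTo (suc n))         ≡⟨ cong (sumOver g) (sym (Listₚ.upTo-∷ʳ n)) ⟩
  sumOver g (upTo n ++ n ∷ [])     ≡⟨ sumOver-++ g (upTo n) (n ∷ []) ⟩
  sumBelow g n + (g n + 0)         ≡⟨ cong (sumBelow g n +_) (+-identityʳ (g n)) ⟩
  sumBelow g n + g n               ∎
  where open ≡-Reasoning

sumBelow-vanishing : ∀ g n → (∀ k → k < n → g k ≡ 0) → sumBelow g n ≡ 0
sumBelow-vanishing g zero    g≗0 = refl
sumBelow-vanishing g (suc n) g≗0 = trans (sumBelow-suc g n)
  (cong₂ _+_ (sumBelow-vanishing g n (λ k k<n → g≗0 k (m<n⇒m<1+n k<n))) (g≗0 n ≤-refl))

sumBelow-single : ∀ g K → (∀ k → k ≢ K → g k ≡ 0) → ∀ n → K < n → sumBelow g n ≡ g K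
sumBelow-single g K g≗0 (suc n) (s≤s K≤n) with K ≟ n
... | yes refl = trans (sumBelow-suc g K)
                   (cong (_+ g K) (sumBelow-vanishing g K (λ k k<K → g≗0 k (<⇒≢ k<K))))
... | no  K≢n  = trans (sumBelow-suc g n)
                   (trans (cong₂ _+_ (sumBelow-single g K g≗0 n (≤∧≢⇒< K≤n K≢n)) (g≗0 n (≢-sym K≢n)))
                          (+-identityʳ (g K)))

sumBelow-nonzero : ∀ g n → sumBelow g n ≢ 0 → ∃[ k ] g k ≢ 0
sumBelow-nonzero g zero    Σ≢0 = ⊥-elim (Σ≢0 refl)
sumBelow-nonzero g (suc n) Σ≢0 with g n ≟ 0
... | no  gn≢0 = n , gn≢0
... | yes gn≡0 = sumBelow-nonzero g n λ Σ≡0 →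
                   Σ≢0 (trans (sumBelow-suc g n) (cong₂ _+_ Σ≡0 gn≡0))

sumBelow-truncate : ∀ g M → (∀ k → M ≤ k → g k ≡ 0) → ∀ N → M ≤ N → sumBelow g N ≡ sumBelow g M
sumBelow-truncate g M g≗0 N M≤N with m≤n⇒∃[o]m+o≡n M≤N
... | o , refl = go o
  where
  go : ∀ o → sumBelow g (M + o) ≡ sumBelow g M
  go zero    = cong (sumBelow g) (+-identityʳ M)
  go (suc o) = begin
    sumBelow g (M + suc o)            ≡⟨ cong (sumBelow g) (+-suc M o) ⟩
    sumBelow g (suc (M + o))          ≡⟨ sumBelow-suc g (M + o) ⟩
    sumBelow g (M + o) + g (M + o)    ≡⟨ cong₂ _+_ (go o) (g≗0 (M + o) (m≤m+n M o)) ⟩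
    sumBelow g M + 0                  ≡⟨ +-identityʳ _ ⟩
    sumBelow g M                      ∎
    where open ≡-Reasoning

sumOver-sumBelow-comm : (g : A → ℕ → ℕ) (xs : List A) (N : ℕ) →
  sumOver (λ x → sumBelow (g x) N) xs ≡ sumBelow (λ k → sumOver (λ x → g x k) xs) N
sumOver-sumBelow-comm g xs zero    = sumOver-zero (λ _ → refl) xs
sumOver-sumBelow-comm g xs (suc N) = begin
  sumOver (λ x → sumBelow (g x) (suc N)) xs
    ≡⟨ sumOver-cong (λ x → sumBelow-suc (g x) N) xs ⟩
  sumOver (λ x → sumBelow (g x) N + g x N) xs
    ≡⟨ sumOver-+ (λ x → sumBelow (g x) N) (λ x → g x N) xs ⟩
  sumOver (λ x → sumBelow (g x) N) xs + sumOver (λ x → g x N) xs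
    ≡⟨ cong (_+ sumOver (λ x → g x N) xs) (sumOver-sumBelow-comm g xs N) ⟩
  sumBelow (λ k → sumOver (λ x → g x k) xs) N + sumOver (λ x → g x N) xs
    ≡⟨ sumBelow-suc (λ k → sumOver (λ x → g x k) xs) N ⟨
  sumBelow (λ k → sumOver (λ x → g x k) xs) (suc N) ∎
  where open ≡-Reasoning

sumBelow-shift : ∀ c (h : ℕ → ℕ) N →
                 sumBelow (λ i → if c ≤ᵇ i then h (i ∸ c) else 0) N ≡ sumBelow h (N ∸ c)
sumBelow-shift zero    h zero    = refl
sumBelow-shift (suc c) h zero    = refl
sumBelow-shift c       h (suc N) = begin
  sumBelow shifted (suc N)          ≡⟨ sumBelow-suc shifted N ⟩
  sumBelow shifted N + shifted N    ≡⟨ cong (_+ shifted N) (sumBelow-shift c h N) ⟩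
  sumBelow h (N ∸ c) + shifted N    ≡⟨ lastTerm (≤-<-connex c N) ⟩
  sumBelow h (suc N ∸ c)            ∎
  where
  open ≡-Reasoning
  shifted : ℕ → ℕ
  shifted i = if c ≤ᵇ i then h (i ∸ c) else 0
  lastTerm : c ≤ N ⊎ N < c → sumBelow h (N ∸ c) + shifted N ≡ sumBelow h (suc N ∸ c)
  lastTerm (inj₁ c≤N) = begin
    sumBelow h (N ∸ c) + shifted N
      ≡⟨ cong (sumBelow h (N ∸ c) +_) (cong (if_then h (N ∸ c) else 0) (≤⇒≤ᵇ≡true c≤N)) ⟩
    sumBelow h (N ∸ c) + h (N ∸ c)      ≡⟨ sumBelow-suc h (N ∸ c) ⟨
    sumBelow h (suc (N ∸ c))            ≡⟨ cong (sumBelow h) (+-∸-assoc 1 c≤N) ⟨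
    sumBelow h (suc N ∸ c)              ∎
  lastTerm (inj₂ N<c) = begin
    sumBelow h (N ∸ c) + shifted N
      ≡⟨ cong (sumBelow h (N ∸ c) +_) (cong (if_then h (N ∸ c) else 0) (≰⇒≤ᵇ≡false (<⇒≱ N<c))) ⟩
    sumBelow h (N ∸ c) + 0              ≡⟨ +-identityʳ _ ⟩
    sumBelow h (N ∸ c)
      ≡⟨ cong (sumBelow h) (trans (m≤n⇒m∸n≡0 (<⇒≤ N<c)) (sym (m≤n⇒m∸n≡0 N<c))) ⟩
    sumBelow h (suc N ∸ c)              ∎

infixl 6 _⊞_ _⊟_
infixr 7 _·ᵥ_

_⊞_ _⊟_ : Vec ℕ n → Vec ℕ n → Vec ℕ n
_⊞_ = zipWith _+_
_⊟_ = zipWith _∸_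

_·ᵥ_ : ℕ → Vec ℕ n → Vec ℕ n
k ·ᵥ β = V.map (k *_) β

u⊞[m⊟u]≡m : (u m : Vec ℕ n) → (u ≤ᵥ m) ≡ true → u ⊞ (m ⊟ u) ≡ m
u⊞[m⊟u]≡m []      []      _  = refl
u⊞[m⊟u]≡m (a ∷ u) (b ∷ m) le with ∧≡true⇒× (a ≤ᵇ b) (u ≤ᵥ m) le
... | a≤b , u≤m = cong₂ _∷_ (m+[n∸m]≡n (≤ᵇ≡true⇒≤ a b a≤b)) (u⊞[m⊟u]≡m u m u≤m)

u≤ᵥu⊞m : (u m : Vec ℕ n) → (u ≤ᵥ (u ⊞ m)) ≡ true
u≤ᵥu⊞m []      []      = refl
u≤ᵥu⊞m (a ∷ u) (b ∷ m) = cong₂ _∧_ (≤⇒≤ᵇ≡true (m≤m+n a b)) (u≤ᵥu⊞m u m)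

[u⊞m]⊟u≡m : (u m : Vec ℕ n) → (u ⊞ m) ⊟ u ≡ m
[u⊞m]⊟u≡m []      []      = refl
[u⊞m]⊟u≡m (a ∷ u) (b ∷ m) = cong₂ _∷_ (m+n∸m≡n a b) ([u⊞m]⊟u≡m u m)

≤ᵥ⇒lookup≤ : (u m : Vec ℕ n) → (u ≤ᵥ m) ≡ true → ∀ i → lookup u i ≤ lookup m i
≤ᵥ⇒lookup≤ (a ∷ u) (b ∷ m) le zero    = ≤ᵇ≡true⇒≤ a b (proj₁ (∧≡true⇒× (a ≤ᵇ b) _ le))
≤ᵥ⇒lookup≤ (a ∷ u) (b ∷ m) le (suc i) = ≤ᵥ⇒lookup≤ u m (proj₂ (∧≡true⇒× (a ≤ᵇ b) _ le)) i

lookup≤deg : (m : Vec ℕ n) (i : Fin n) → lookup m i ≤ deg m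
lookup≤deg (a ∷ m) zero    = m≤m+n a _
lookup≤deg (a ∷ m) (suc i) = ≤-trans (lookup≤deg m i) (m≤n+m _ a)

≡ᵥ⇒≡ : (u m : Vec ℕ n) → (u ≡ᵥ m) ≡ true → u ≡ m
≡ᵥ⇒≡ []      []      _  = refl
≡ᵥ⇒≡ (a ∷ u) (b ∷ m) eq with ∧≡true⇒× (a ≡ᵇ b) (u ≡ᵥ m) eq
... | a≡b , u≡m = cong₂ _∷_ (≡ᵇ≡true⇒≡ a b a≡b) (≡ᵥ⇒≡ u m u≡m)

lookup-·ᵥ : ∀ k (β : Vec ℕ n) i → lookup (k ·ᵥ β) i ≡ k * lookup β i
lookup-·ᵥ k β i = Vecₚ.lookup-map i (k *_) β

lookup-⊟·ᵥ : ∀ (m β : Vec ℕ n) k i → lookup (m ⊟ k ·ᵥ β) i ≡ lookup m i ∸ k * lookup β i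
lookup-⊟·ᵥ m β k i = trans (Vecₚ.lookup-zipWith _∸_ i m (k ·ᵥ β)) (cong (lookup m i ∸_) (lookup-·ᵥ k β i))

≋-setoid : ℕ → Setoid 0ℓ 0ℓ
≋-setoid n = record
  { Carrier       = Ser n
  ; _≈_           = _≋_
  ; isEquivalence = record
    { refl  = λ _ → refl
    ; sym   = λ f≋g m → sym (f≋g m)
    ; trans = λ f≋g g≋h m → trans (f≋g m) (g≋h m)
    }
  }

⊕-cong : {f f′ g g′ : Ser n} → f ≋ f′ → g ≋ g′ → f ⊕ g ≋ f′ ⊕ g′
⊕-cong f≋f′ g≋g′ m = cong₂ _+_ (f≋f′ m) (g≋g′ m)

-- divOneMinus β f m unfolds definitionally to sumBelow (geometricTerm β f m) (suc (deg m)).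
geometricTerm : Vec ℕ n → Ser n → Vec ℕ n → ℕ → ℕ
geometricTerm β f m k = if (k ·ᵥ β) ≤ᵥ m then f (m ⊟ k ·ᵥ β) else 0

mono-nonzero : (γ m : Vec ℕ n) → mono γ m ≢ 0 → γ ≡ m
mono-nonzero γ m mono≢0 with γ ≡ᵥ m in γ≡ᵥm
... | true  = ≡ᵥ⇒≡ γ m γ≡ᵥm
... | false = ⊥-elim (mono≢0 refl)

divOneMinus-nonzero : ∀ (β : Vec ℕ n) f m → divOneMinus β f m ≢ 0 →
                      ∃[ k ] ∃[ m′ ] m ≡ k ·ᵥ β ⊞ m′ × f m′ ≢ 0
divOneMinus-nonzero β f m Σ≢0 with sumBelow-nonzero (geometricTerm β f m) (suc (deg m)) Σ≢0
... | k , term≢0 with (k ·ᵥ β) ≤ᵥ m in kβ≤m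
... | true  = k , m ⊟ k ·ᵥ β , sym (u⊞[m⊟u]≡m (k ·ᵥ β) m kβ≤m) , term≢0
... | false = ⊥-elim (term≢0 refl)

SupportedOn : Fin n → ℕ → Ser n → Set
SupportedOn i c f = ∀ m → lookup m i ≢ c → f m ≡ 0

mono-supportedOn : (γ : Vec ℕ n) (i : Fin n) → SupportedOn i (lookup γ i) (mono γ)
mono-supportedOn γ i m mᵢ≢γᵢ with γ ≡ᵥ m in γ≡ᵥm
... | true  = ⊥-elim (mᵢ≢γᵢ (cong (λ v → lookup v i) (sym (≡ᵥ⇒≡ γ m γ≡ᵥm))))
... | false = refl

divOneMinus-supportedOn : ∀ {i c} {f : Ser n} β → lookup β i ≡ 0 →
                          SupportedOn i c f → SupportedOn i c (divOneMinus β f)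
divOneMinus-supportedOn {i = i} {c} {f} β βᵢ≡0 f-on m mᵢ≢c = sumOver-zero term≡0 (upTo (suc (deg m)))
  where
  term≡0 : ∀ k → geometricTerm β f m k ≡ 0
  term≡0 k with (k ·ᵥ β) ≤ᵥ m
  ... | false = refl
  ... | true  = f-on (m ⊟ k ·ᵥ β) λ eq → mᵢ≢c (begin
    lookup m i                    ≡⟨ cong (lookup m i ∸_) (trans (cong (k *_) βᵢ≡0) (*-zeroʳ k)) ⟨
    lookup m i ∸ k * lookup β i   ≡⟨ lookup-⊟·ᵥ m β k i ⟨
    lookup (m ⊟ k ·ᵥ β) i         ≡⟨ eq ⟩
    c                             ∎)
    where open ≡-Reasoning

SupportedOn⇒lookup≡ : ∀ {i c} {f : Ser n} {m} → SupportedOn i c f → f m ≢ 0 → lookup m i ≡ c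
SupportedOn⇒lookup≡ {i = i} {c} {m = m} f-on fm≢0 =
  decidable-stable (lookup m i ≟ c) λ mᵢ≢c → fm≢0 (f-on m mᵢ≢c)

-- Expanding at K β + m, only the K-th term lands on the hyperplane mᵢ = c carrying f.
divOneMinus-coeff : ∀ {i c} (β : Vec ℕ n) f K m → lookup β i ≡ 1 → SupportedOn i c f →
                    lookup m i ≡ c → divOneMinus β f (K ·ᵥ β ⊞ m) ≡ f m
divOneMinus-coeff {n = n} {i = i} {c = c} β f K m βᵢ≡1 f-on mᵢ≡c =
  trans (sumBelow-single (geometricTerm β f m̂) K term≡0 (suc (deg m̂)) (s≤s K≤deg)) term-K
  where
  m̂ : Vec ℕ n
  m̂ = K ·ᵥ β ⊞ m
  k·βᵢ : ∀ k → k * lookup β i ≡ k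
  k·βᵢ k = trans (cong (k *_) βᵢ≡1) (*-identityʳ k)
  m̂ᵢ : lookup m̂ i ≡ K + c
  m̂ᵢ = trans (Vecₚ.lookup-zipWith _+_ i (K ·ᵥ β) m)
             (cong₂ _+_ (trans (lookup-·ᵥ K β i) (k·βᵢ K)) mᵢ≡c)
  K≤deg : K ≤ deg m̂
  K≤deg = ≤-trans (m≤m+n K c) (≤-trans (≤-reflexive (sym m̂ᵢ)) (lookup≤deg m̂ i))
  term-K : geometricTerm β f m̂ K ≡ f m
  term-K rewrite u≤ᵥu⊞m (K ·ᵥ β) m = cong f ([u⊞m]⊟u≡m (K ·ᵥ β) m)
  term≡0 : ∀ k → k ≢ K → geometricTerm β f m̂ k ≡ 0
  term≡0 k k≢K with (k ·ᵥ β) ≤ᵥ m̂ in kβ≤m̂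
  ... | false = refl
  ... | true  = f-on (m̂ ⊟ k ·ᵥ β) λ eq → k≢K (∸-cancelˡ-≡ k≤K+c (m≤m+n K c) (begin
    (K + c) ∸ k                      ≡⟨ cong₂ _∸_ m̂ᵢ (k·βᵢ k) ⟨
    lookup m̂ i ∸ k * lookup β i      ≡⟨ lookup-⊟·ᵥ m̂ β k i ⟨
    lookup (m̂ ⊟ k ·ᵥ β) i            ≡⟨ eq ⟩
    c                                ≡⟨ m+n∸m≡n K c ⟨
    (K + c) ∸ K                      ∎))
    where
    open ≡-Reasoning
    k≤K+c : k ≤ K + c
    k≤K+c = subst₂ _≤_ (trans (lookup-·ᵥ k β i) (k·βᵢ k)) m̂ᵢ (≤ᵥ⇒lookup≤ (k ·ᵥ β) m̂ kβ≤m̂ i)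

divOneMinus-coeff≡1 : ∀ {i c} (β : Vec ℕ n) f K m → lookup β i ≡ 1 → SupportedOn i c f →
                      f m ≡ 1 → divOneMinus β f (K ·ᵥ β ⊞ m) ≡ 1
divOneMinus-coeff≡1 β f K m βᵢ≡1 f-on fm≡1 =
  trans (divOneMinus-coeff β f K m βᵢ≡1 f-on (SupportedOn⇒lookup≡ f-on fm≢0)) fm≡1
  where
  fm≢0 : f m ≢ 0
  fm≢0 fm≡0 = 1+n≢0 (trans (sym fm≡1) fm≡0)

divOneMinus-cong : ∀ (β : Vec ℕ n) {f g} → f ≋ g → divOneMinus β f ≋ divOneMinus β g
divOneMinus-cong β {f} {g} f≋g m = sumOver-cong term≡ (upTo (suc (deg m)))
  where
  term≡ : ∀ k → geometricTerm β f m k ≡ geometricTerm β g m k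
  term≡ k with (k ·ᵥ β) ≤ᵥ m
  ... | true  = f≋g (m ⊟ k ·ᵥ β)
  ... | false = refl

divOneMinus-⊕ : ∀ (β : Vec ℕ n) f g → divOneMinus β (f ⊕ g) ≋ divOneMinus β f ⊕ divOneMinus β g
divOneMinus-⊕ β f g m = trans (sumOver-cong term≡ (upTo (suc (deg m))))
  (sumOver-+ (geometricTerm β f m) (geometricTerm β g m) (upTo (suc (deg m))))
  where
  term≡ : ∀ k → geometricTerm β (f ⊕ g) m k ≡ geometricTerm β f m k + geometricTerm β g m k
  term≡ k with (k ·ᵥ β) ≤ᵥ m
  ... | true  = refl
  ... | false = refl

-- Magic labellings of G₂

IsMagic : Vec ℕ 9 → ℕ → Set
IsMagic α s = ∀ v → vertexSum α v ≡ s

-- isMagicWithSum α s is definitionally all (λ v → vertexSum α v ≡ᵇ s) (allFin 6).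
isMagicWithSum⇒IsMagic : ∀ α s → isMagicWithSum α s ≡ true → IsMagic α s
isMagicWithSum⇒IsMagic α s eq v = ≡ᵇ⇒≡ (vertexSum α v) s
  (ListAll.lookup (all⁺ (λ v → vertexSum α v ≡ᵇ s) (allFin 6) (Equivalence.from T-≡ eq)) (∈-allFin v))

IsMagic⇒isMagicWithSum : ∀ α s → IsMagic α s → isMagicWithSum α s ≡ true
IsMagic⇒isMagicWithSum α s magic = Equivalence.to T-≡ (all⁻ (λ v → vertexSum α v ≡ᵇ s) {xs = allFin 6}
  (ListAll.tabulate λ {v} _ → ≡⇒≡ᵇ (vertexSum α v) s (magic v)))

-- The vertex sums of a concrete labelling normalise to x + (y + (z + 0)).
private
  sum₃ : ∀ x y z → x + (y + (z + 0)) ≡ x + y + z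
  sum₃ = solve-∀

  sum₃-swap : ∀ x y z → x + (y + (z + 0)) ≡ y + x + z
  sum₃-swap = solve-∀

vertexEquation : ∀ x y z s → x + (y + (z + 0)) ≡ s → x + y + z ≡ s
vertexEquation x y z s = trans (sym (sum₃ x y z))

symmetricLabelling : (x₁ x₂ x₃ x₇ x₈ x₉ : ℕ) → Vec ℕ 9
symmetricLabelling x₁ x₂ x₃ x₇ x₈ x₉ = x₁ ∷ x₂ ∷ x₃ ∷ x₃ ∷ x₁ ∷ x₂ ∷ x₇ ∷ x₈ ∷ x₉ ∷ []

symmetricLabelling-isMagic : ∀ x₁ x₂ x₃ x₇ x₈ x₉ s →
  x₁ + x₂ + x₇ ≡ s → x₂ + x₃ + x₈ ≡ s → x₁ + x₃ + x₉ ≡ s →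
  IsMagic (symmetricLabelling x₁ x₂ x₃ x₇ x₈ x₉) s
symmetricLabelling-isMagic x₁ x₂ x₃ x₇ x₈ x₉ s v₂ v₄ v₆ = λ where
  zero                                → trans (sum₃-swap x₃ x₂ x₈) v₄
  (suc zero)                          → trans (sum₃ x₁ x₂ x₇) v₂
  (suc (suc zero))                    → trans (sum₃-swap x₃ x₁ x₉) v₆
  (suc (suc (suc zero)))              → trans (sum₃ x₂ x₃ x₈) v₄
  (suc (suc (suc (suc zero))))        → trans (sum₃ x₁ x₂ x₇) v₂
  (suc (suc (suc (suc (suc zero)))))  → trans (sum₃ x₁ x₃ x₉) v₆

symmetricLabelling-vertexEquations : ∀ x₁ x₂ x₃ x₇ x₈ x₉ s →
  IsMagic (symmetricLabelling x₁ x₂ x₃ x₇ x₈ x₉) s →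
  (x₁ + x₂ + x₇ ≡ s) × (x₂ + x₃ + x₈ ≡ s) × (x₁ + x₃ + x₉ ≡ s)
symmetricLabelling-vertexEquations x₁ x₂ x₃ x₇ x₈ x₉ s magic =
  vertexEquation x₁ x₂ x₇ s (magic (# 1)) ,
  vertexEquation x₂ x₃ x₈ s (magic (# 3)) ,
  vertexEquation x₁ x₃ x₉ s (magic (# 5))

isMagic⇒symmetric : ∀ x₁ x₂ x₃ x₄ x₅ x₆ x₇ x₈ x₉ s →
  IsMagic (x₁ ∷ x₂ ∷ x₃ ∷ x₄ ∷ x₅ ∷ x₆ ∷ x₇ ∷ x₈ ∷ x₉ ∷ []) s → x₄ ≡ x₃ × x₅ ≡ x₁ × x₆ ≡ x₂
isMagic⇒symmetric x₁ x₂ x₃ x₄ x₅ x₆ x₇ x₈ x₉ s magic = x₄≡x₃ , x₅≡x₁ , x₆≡x₂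
  where
  open ≡-Reasoning
  v₁ : x₄ + x₆ + x₈ ≡ s
  v₁ = vertexEquation x₄ x₆ x₈ s (magic (# 0))
  v₂ : x₁ + x₂ + x₇ ≡ s
  v₂ = vertexEquation x₁ x₂ x₇ s (magic (# 1))
  v₃ : x₄ + x₅ + x₉ ≡ s
  v₃ = vertexEquation x₄ x₅ x₉ s (magic (# 2))
  v₄ : x₂ + x₃ + x₈ ≡ s
  v₄ = vertexEquation x₂ x₃ x₈ s (magic (# 3))
  v₅ : x₅ + x₆ + x₇ ≡ s
  v₅ = vertexEquation x₅ x₆ x₇ s (magic (# 4))
  v₆ : x₁ + x₃ + x₉ ≡ s
  v₆ = vertexEquation x₁ x₃ x₉ s (magic (# 5))
  -- The vertex sums at v₁, v₂, v₃ and at v₄, v₅, v₆ both total 3s, and they differ by 2x₄ − 2x₃.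
  x₄≡x₃ : x₄ ≡ x₃
  x₄≡x₃ = *-cancelˡ-≡ x₄ x₃ 2 (+-cancelʳ-≡ (x₁ + x₂ + x₅ + x₆ + x₇ + x₈ + x₉) (2 * x₄) (2 * x₃) (begin
    2 * x₄ + (x₁ + x₂ + x₅ + x₆ + x₇ + x₈ + x₉)
      ≡⟨ solve (x₁ L.∷ x₂ L.∷ x₃ L.∷ x₄ L.∷ x₅ L.∷ x₆ L.∷ x₇ L.∷ x₈ L.∷ x₉ L.∷ L.[]) ⟩
    (x₄ + x₆ + x₈) + (x₁ + x₂ + x₇) + (x₄ + x₅ + x₉)  ≡⟨ cong₂ _+_ (cong₂ _+_ v₁ v₂) v₃ ⟩
    s + s + s                                         ≡⟨ cong₂ _+_ (cong₂ _+_ v₄ v₅) v₆ ⟨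
    (x₂ + x₃ + x₈) + (x₅ + x₆ + x₇) + (x₁ + x₃ + x₉)
      ≡⟨ solve (x₁ L.∷ x₂ L.∷ x₃ L.∷ x₄ L.∷ x₅ L.∷ x₆ L.∷ x₇ L.∷ x₈ L.∷ x₉ L.∷ L.[]) ⟩
    2 * x₃ + (x₁ + x₂ + x₅ + x₆ + x₇ + x₈ + x₉) ∎))
  x₆≡x₂ : x₆ ≡ x₂
  x₆≡x₂ = +-cancelˡ-≡ x₃ x₆ x₂ (begin
    x₃ + x₆   ≡⟨ cong (_+ x₆) x₄≡x₃ ⟨
    x₄ + x₆   ≡⟨ +-cancelʳ-≡ x₈ (x₄ + x₆) (x₂ + x₃) (trans v₁ (sym v₄)) ⟩
    x₂ + x₃   ≡⟨ +-comm x₂ x₃ ⟩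
    x₃ + x₂   ∎)
  x₅≡x₁ : x₅ ≡ x₁
  x₅≡x₁ = +-cancelˡ-≡ x₃ x₅ x₁ (begin
    x₃ + x₅   ≡⟨ cong (_+ x₅) x₄≡x₃ ⟨
    x₄ + x₅   ≡⟨ +-cancelʳ-≡ x₉ (x₄ + x₅) (x₁ + x₃) (trans v₃ (sym v₆)) ⟩
    x₁ + x₃   ≡⟨ +-comm x₁ x₃ ⟩
    x₃ + x₁   ∎)

zeros : Vec ℕ 10
zeros = V.replicate 10 0

family₁ family₂ : ℕ → ℕ → ℕ → ℕ → Vec ℕ 10
family₁ a b c d = a ·ᵥ m158 ⊞ (b ·ᵥ m269 ⊞ (c ·ᵥ m347 ⊞ (d ·ᵥ m789 ⊞ zeros)))
family₂ a b c e = a ·ᵥ m158 ⊞ (b ·ᵥ m269 ⊞ (c ·ᵥ m347 ⊞ (e ·ᵥ m123456 ⊞ m123456)))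

family₁-labels : ∀ a b c d {s} → a + b + c + d ≡ s →
  family₁ a b c d ≡ symmetricLabelling a b c (c + d) (a + d) (b + d) ∷ʳ s
family₁-labels a b c d refl rewrite *-identityʳ a | *-zeroʳ a | *-identityʳ b | *-zeroʳ b
  | *-identityʳ c | *-zeroʳ c | *-identityʳ d | *-zeroʳ d
  | +-identityʳ a | +-identityʳ b | +-identityʳ c | +-identityʳ d
  | +-assoc (a + b) c d | +-assoc a b (c + d) = refl

family₂-labels : ∀ a b c e {s} → a + b + c + 2 * suc e ≡ s →
  family₂ a b c e ≡ symmetricLabelling (a + suc e) (b + suc e) (c + suc e) c a b ∷ʳ s
family₂-labels a b c e sum≡s rewrite *-identityʳ a | *-zeroʳ a | *-identityʳ b | *-zeroʳ b
  | *-identityʳ c | *-zeroʳ c | *-identityʳ e | *-zeroʳ e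
  | +-identityʳ a | +-identityʳ b | +-identityʳ c | +-comm e 1 =
  cong (symmetricLabelling (a + suc e) (b + suc e) (c + suc e) c a b ∷ʳ_) (trans (total a b c e) sum≡s)
  where
  total : ∀ a b c e → a + (b + (c + (e * 2 + 2))) ≡ a + b + c + 2 * suc e
  total = solve-∀

Family₁ Family₂ : Vec ℕ 10 → Set
Family₁ m = ∃[ a ] ∃[ b ] ∃[ c ] ∃[ d ] m ≡ family₁ a b c d
Family₂ m = ∃[ a ] ∃[ b ] ∃[ c ] ∃[ e ] m ≡ family₂ a b c e

vertexEquations⇒family₁ : ∀ a b c d x₇ x₉ s →
  a + b + x₇ ≡ s → b + c + (a + d) ≡ s → a + c + x₉ ≡ s →
  Family₁ (symmetricLabelling a b c x₇ (a + d) x₉ ∷ʳ s)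
vertexEquations⇒family₁ a b c d x₇ x₉ s v₂ v₄ v₆ = a , b , c , d ,
  trans (cong₂ (λ x₇ x₉ → symmetricLabelling a b c x₇ (a + d) x₉ ∷ʳ s) x₇≡c+d x₉≡b+d)
        (sym (family₁-labels a b c d total))
  where
  open ≡-Reasoning
  x₇≡c+d : x₇ ≡ c + d
  x₇≡c+d = +-cancelˡ-≡ (a + b) x₇ (c + d) (begin
    a + b + x₇       ≡⟨ trans v₂ (sym v₄) ⟩
    b + c + (a + d)  ≡⟨ solve (a L.∷ b L.∷ c L.∷ d L.∷ L.[]) ⟩
    a + b + (c + d)  ∎)
  x₉≡b+d : x₉ ≡ b + d
  x₉≡b+d = +-cancelˡ-≡ (a + c) x₉ (b + d) (begin
    a + c + x₉       ≡⟨ trans v₆ (sym v₄) ⟩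
    b + c + (a + d)  ≡⟨ solve (a L.∷ b L.∷ c L.∷ d L.∷ L.[]) ⟩
    a + c + (b + d)  ∎)
  total : a + b + c + d ≡ s
  total = begin
    a + b + c + d    ≡⟨ solve (a L.∷ b L.∷ c L.∷ d L.∷ L.[]) ⟩
    b + c + (a + d)  ≡⟨ v₄ ⟩
    s                ∎

vertexEquations⇒family₂ : ∀ a e x₂ x₃ x₇ x₉ s →
  a + suc e + x₂ + x₇ ≡ s → x₂ + x₃ + a ≡ s → a + suc e + x₃ + x₉ ≡ s →
  Family₂ (symmetricLabelling (a + suc e) x₂ x₃ x₇ a x₉ ∷ʳ s)
vertexEquations⇒family₂ a e x₂ x₃ x₇ x₉ s v₂ v₄ v₆ = a , x₉ , x₇ , e ,
  trans (cong₂ (λ x₂ x₃ → symmetricLabelling (a + suc e) x₂ x₃ x₇ a x₉ ∷ʳ s) x₂≡x₉+1+e x₃≡x₇+1+e)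
        (sym (family₂-labels a x₉ x₇ e total))
  where
  open ≡-Reasoning
  x₃≡x₇+1+e : x₃ ≡ x₇ + suc e
  x₃≡x₇+1+e = +-cancelʳ-≡ (x₂ + a) x₃ (x₇ + suc e) (begin
    x₃ + (x₂ + a)          ≡⟨ solve (a L.∷ x₂ L.∷ x₃ L.∷ L.[]) ⟩
    x₂ + x₃ + a            ≡⟨ trans v₄ (sym v₂) ⟩
    a + suc e + x₂ + x₇    ≡⟨ solve (a L.∷ e L.∷ x₂ L.∷ x₇ L.∷ L.[]) ⟩
    x₇ + suc e + (x₂ + a)  ∎)
  x₂≡x₉+1+e : x₂ ≡ x₉ + suc e
  x₂≡x₉+1+e = +-cancelʳ-≡ (x₃ + a) x₂ (x₉ + suc e) (begin
    x₂ + (x₃ + a)          ≡⟨ +-assoc x₂ x₃ a ⟨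
    x₂ + x₃ + a            ≡⟨ trans v₄ (sym v₆) ⟩
    a + suc e + x₃ + x₉    ≡⟨ solve (a L.∷ e L.∷ x₃ L.∷ x₉ L.∷ L.[]) ⟩
    x₉ + suc e + (x₃ + a)  ∎)
  total : a + x₉ + x₇ + 2 * suc e ≡ s
  total = begin
    a + x₉ + x₇ + 2 * suc e        ≡⟨ solve (a L.∷ e L.∷ x₇ L.∷ x₉ L.∷ L.[]) ⟩
    x₉ + suc e + (x₇ + suc e) + a  ≡⟨ cong₂ (λ x₂ x₃ → x₂ + x₃ + a) x₂≡x₉+1+e x₃≡x₇+1+e ⟨
    x₂ + x₃ + a                    ≡⟨ v₄ ⟩
    s                              ∎

-- α₁ ≤ α₈ gives the first family with d = α₈ − α₁, and α₈ < α₁ the second with e + 1 = α₁ − α₈.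
vertexEquations⇒family : ∀ x₁ x₂ x₃ x₇ x₈ x₉ s →
  x₁ + x₂ + x₇ ≡ s → x₂ + x₃ + x₈ ≡ s → x₁ + x₃ + x₉ ≡ s →
  Family₁ (symmetricLabelling x₁ x₂ x₃ x₇ x₈ x₉ ∷ʳ s) ⊎ Family₂ (symmetricLabelling x₁ x₂ x₃ x₇ x₈ x₉ ∷ʳ s)
vertexEquations⇒family x₁ x₂ x₃ x₇ x₈ x₉ s v₂ v₄ v₆ with ≤-<-connex x₁ x₈
... | inj₁ x₁≤x₈ with m≤n⇒∃[o]m+o≡n x₁≤x₈
...   | d , refl = inj₁ (vertexEquations⇒family₁ x₁ x₂ x₃ d x₇ x₉ s v₂ v₄ v₆)
vertexEquations⇒family x₁ x₂ x₃ x₇ x₈ x₉ s v₂ v₄ v₆ | inj₂ x₈<x₁ with m≤n⇒∃[o]m+o≡n x₈<x₁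
...   | e , 1+x₈+e≡x₁ with trans (+-suc x₈ e) 1+x₈+e≡x₁
...     | refl = inj₂ (vertexEquations⇒family₂ x₈ e x₂ x₃ x₇ x₉ s v₂ v₄ v₆)

isMagic⇒family : ∀ α s → IsMagic α s → Family₁ (α ∷ʳ s) ⊎ Family₂ (α ∷ʳ s)
isMagic⇒family (x₁ ∷ x₂ ∷ x₃ ∷ x₄ ∷ x₅ ∷ x₆ ∷ x₇ ∷ x₈ ∷ x₉ ∷ []) s magic
  with isMagic⇒symmetric x₁ x₂ x₃ x₄ x₅ x₆ x₇ x₈ x₉ s magic
... | refl , refl , refl with symmetricLabelling-vertexEquations x₁ x₂ x₃ x₇ x₈ x₉ s magic
...   | v₂ , v₄ , v₆ = vertexEquations⇒family x₁ x₂ x₃ x₇ x₈ x₉ s v₂ v₄ v₆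

magicExponent⇒family : ∀ m → isMagicWithSum (init m) (last m) ≡ true → Family₁ m ⊎ Family₂ m
magicExponent⇒family m magic with V.initLast m
... | α , s , refl = isMagic⇒family α s (isMagicWithSum⇒IsMagic α s magic)

family₁-isMagic : ∀ {m} → Family₁ m → isMagicWithSum (init m) (last m) ≡ true
family₁-isMagic (a , b , c , d , refl) =
  subst (λ m → isMagicWithSum (init m) (last m) ≡ true) (sym (family₁-labels a b c d refl))
    (IsMagic⇒isMagicWithSum (symmetricLabelling a b c (c + d) (a + d) (b + d)) (a + b + c + d)
      (symmetricLabelling-isMagic a b c (c + d) (a + d) (b + d) (a + b + c + d)
      (solve (a L.∷ b L.∷ c L.∷ d L.∷ L.[]))
      (solve (a L.∷ b L.∷ c L.∷ d L.∷ L.[]))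
      (solve (a L.∷ b L.∷ c L.∷ d L.∷ L.[]))))

family₂-isMagic : ∀ {m} → Family₂ m → isMagicWithSum (init m) (last m) ≡ true
family₂-isMagic (a , b , c , e , refl) =
  subst (λ m → isMagicWithSum (init m) (last m) ≡ true) (sym (family₂-labels a b c e refl))
    (IsMagic⇒isMagicWithSum (symmetricLabelling (a + suc e) (b + suc e) (c + suc e) c a b)
      (a + b + c + 2 * suc e)
      (symmetricLabelling-isMagic (a + suc e) (b + suc e) (c + suc e) c a b (a + b + c + 2 * suc e)
      (solve (a L.∷ b L.∷ c L.∷ e L.∷ L.[]))
      (solve (a L.∷ b L.∷ c L.∷ e L.∷ L.[]))
      (solve (a L.∷ b L.∷ c L.∷ e L.∷ L.[]))))

family₁≢family₂ : ∀ a b c d a′ b′ c′ e → family₁ a b c d ≢ family₂ a′ b′ c′ e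
family₁≢family₂ a b c d a′ b′ c′ e eq = m≢1+m+n a′ (begin
  a′                  ≡⟨ label (# 7) ⟨
  a + d               ≡⟨ cong (_+ d) (label (# 0)) ⟩
  a′ + suc e + d      ≡⟨ solve (a′ L.∷ e L.∷ d L.∷ L.[]) ⟩
  suc (a′ + (e + d))  ∎)
  where
  open ≡-Reasoning
  labels₁ labels₂ : Vec ℕ 10
  labels₁ = symmetricLabelling a b c (c + d) (a + d) (b + d) ∷ʳ (a + b + c + d)
  labels₂ = symmetricLabelling (a′ + suc e) (b′ + suc e) (c′ + suc e) c′ a′ b′ ∷ʳ (a′ + b′ + c′ + 2 * suc e)
  label : ∀ i → lookup labels₁ i ≡ lookup labels₂ i
  label i = cong (λ v → lookup v i)
    (trans (sym (family₁-labels a b c d refl)) (trans eq (family₂-labels a′ b′ c′ e refl)))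

family₁⇒¬family₂ : ∀ {m} → Family₁ m → ¬ Family₂ m
family₁⇒¬family₂ (a , b , c , d , refl) (a′ , b′ , c′ , e , eq) = family₁≢family₂ a b c d a′ b′ c′ e eq

summand₁ summand₂ : Ser 10
summand₁ = divOneMinus m158 (divOneMinus m269 (divOneMinus m347 (divOneMinus m789 one)))
summand₂ = divOneMinus m158 (divOneMinus m269 (divOneMinus m347 (divOneMinus m123456 (mono m123456))))

-- Peel the factors from the outside in, reading K off a coordinate where that factor's exponent
-- is 1 and every inner exponent is 0: x₁, x₂, x₃, x₇ here and x₈, x₉, x₇, x₁ for summand₂.
summand₁-family₁ : ∀ a b c d → summand₁ (family₁ a b c d) ≡ 1
summand₁-family₁ a b c d =
  divOneMinus-coeff≡1 m158 _ a m₁ refl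
    (divOneMinus-supportedOn m269 refl (divOneMinus-supportedOn m347 refl
      (divOneMinus-supportedOn m789 refl (mono-supportedOn zeros (# 0)))))
  (divOneMinus-coeff≡1 m269 _ b m₂ refl
    (divOneMinus-supportedOn m347 refl (divOneMinus-supportedOn m789 refl (mono-supportedOn zeros (# 1))))
  (divOneMinus-coeff≡1 m347 _ c m₃ refl
    (divOneMinus-supportedOn m789 refl (mono-supportedOn zeros (# 2)))
  (divOneMinus-coeff≡1 m789 _ d zeros refl (mono-supportedOn zeros (# 6)) refl)))
  where
  m₁ m₂ m₃ : Vec ℕ 10
  m₃ = d ·ᵥ m789 ⊞ zeros
  m₂ = c ·ᵥ m347 ⊞ m₃
  m₁ = b ·ᵥ m269 ⊞ m₂

summand₂-family₂ : ∀ a b c e → summand₂ (family₂ a b c e) ≡ 1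
summand₂-family₂ a b c e =
  divOneMinus-coeff≡1 m158 _ a m₁ refl
    (divOneMinus-supportedOn m269 refl (divOneMinus-supportedOn m347 refl
      (divOneMinus-supportedOn m123456 refl (mono-supportedOn m123456 (# 7)))))
  (divOneMinus-coeff≡1 m269 _ b m₂ refl
    (divOneMinus-supportedOn m347 refl
      (divOneMinus-supportedOn m123456 refl (mono-supportedOn m123456 (# 8))))
  (divOneMinus-coeff≡1 m347 _ c m₃ refl
    (divOneMinus-supportedOn m123456 refl (mono-supportedOn m123456 (# 6)))
  (divOneMinus-coeff≡1 m123456 _ e m123456 refl (mono-supportedOn m123456 (# 0)) refl)))
  where
  m₁ m₂ m₃ : Vec ℕ 10
  m₃ = e ·ᵥ m123456 ⊞ m123456
  m₂ = c ·ᵥ m347 ⊞ m₃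
  m₁ = b ·ᵥ m269 ⊞ m₂

summand₁-nonzero : ∀ m → summand₁ m ≢ 0 → Family₁ m
summand₁-nonzero m ≢0 with divOneMinus-nonzero m158 _ m ≢0
... | a , m₁ , refl , ≢0₁ with divOneMinus-nonzero m269 _ m₁ ≢0₁
... | b , m₂ , refl , ≢0₂ with divOneMinus-nonzero m347 _ m₂ ≢0₂
... | c , m₃ , refl , ≢0₃ with divOneMinus-nonzero m789 _ m₃ ≢0₃
... | d , m₄ , refl , ≢0₄ with mono-nonzero zeros m₄ ≢0₄
... | refl = a , b , c , d , refl

summand₂-nonzero : ∀ m → summand₂ m ≢ 0 → Family₂ m
summand₂-nonzero m ≢0 with divOneMinus-nonzero m158 _ m ≢0
... | a , m₁ , refl , ≢0₁ with divOneMinus-nonzero m269 _ m₁ ≢0₁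
... | b , m₂ , refl , ≢0₂ with divOneMinus-nonzero m347 _ m₂ ≢0₂
... | c , m₃ , refl , ≢0₃ with divOneMinus-nonzero m123456 _ m₃ ≢0₃
... | e , m₄ , refl , ≢0₄ with mono-nonzero m123456 m₄ ≢0₄
... | refl = a , b , c , e , refl

summand₁-coeff : ∀ m → (Family₁ m → summand₁ m ≡ 1) × (¬ Family₁ m → summand₁ m ≡ 0)
summand₁-coeff m = (λ { (a , b , c , d , refl) → summand₁-family₁ a b c d })
                 , λ ¬fam → ≢0⇒≡0 λ ≢0 → ¬fam (summand₁-nonzero m ≢0)

summand₂-coeff : ∀ m → (Family₂ m → summand₂ m ≡ 1) × (¬ Family₂ m → summand₂ m ≡ 0)
summand₂-coeff m = (λ { (a , b , c , e , refl) → summand₂-family₂ a b c e })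
                 , λ ¬fam → ≢0⇒≡0 λ ≢0 → ¬fam (summand₂-nonzero m ≢0)

FG₂≋summands : FG₂ ≋ summand₁ ⊕ summand₂
FG₂≋summands m with isMagicWithSum (init m) (last m) in magic
... | true with magicExponent⇒family m magic
...   | inj₁ fam₁ = sym (cong₂ _+_ (proj₁ (summand₁-coeff m) fam₁)
                                   (proj₂ (summand₂-coeff m) (family₁⇒¬family₂ fam₁)))
...   | inj₂ fam₂ = sym (cong₂ _+_ (proj₂ (summand₁-coeff m) (λ fam₁ → family₁⇒¬family₂ fam₁ fam₂))
                                   (proj₁ (summand₂-coeff m) fam₂))
FG₂≋summands m | false =
  sym (cong₂ _+_ (proj₂ (summand₁-coeff m) λ fam₁ → true≢false (trans (sym (family₁-isMagic fam₁)) magic))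
                 (proj₂ (summand₂-coeff m) λ fam₂ → true≢false (trans (sym (family₂-isMagic fam₂)) magic)))
  where
  true≢false : true ≢ false
  true≢false ()

-- Setting x₁ = ⋯ = x₉ = 1

≤ᵥ-∷ʳ : (u w : Vec ℕ n) (a b : ℕ) → ((u ∷ʳ a) ≤ᵥ (w ∷ʳ b)) ≡ (u ≤ᵥ w) ∧ (a ≤ᵇ b)
≤ᵥ-∷ʳ []      []      a b = ∧-identityʳ (a ≤ᵇ b)
≤ᵥ-∷ʳ (x ∷ u) (y ∷ w) a b =
  trans (cong ((x ≤ᵇ y) ∧_) (≤ᵥ-∷ʳ u w a b)) (sym (∧-assoc (x ≤ᵇ y) (u ≤ᵥ w) (a ≤ᵇ b)))

≡ᵥ-∷ʳ : (u w : Vec ℕ n) (a b : ℕ) → ((u ∷ʳ a) ≡ᵥ (w ∷ʳ b)) ≡ (u ≡ᵥ w) ∧ (a ≡ᵇ b)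
≡ᵥ-∷ʳ []      []      a b = ∧-identityʳ (a ≡ᵇ b)
≡ᵥ-∷ʳ (x ∷ u) (y ∷ w) a b =
  trans (cong ((x ≡ᵇ y) ∧_) (≡ᵥ-∷ʳ u w a b)) (sym (∧-assoc (x ≡ᵇ y) (u ≡ᵥ w) (a ≡ᵇ b)))

⊟-∷ʳ : (w u : Vec ℕ n) (b a : ℕ) → (w ∷ʳ b) ⊟ (u ∷ʳ a) ≡ (w ⊟ u) ∷ʳ (b ∸ a)
⊟-∷ʳ []      []      b a = refl
⊟-∷ʳ (x ∷ w) (y ∷ u) b a = cong ((x ∸ y) ∷_) (⊟-∷ʳ w u b a)

⊞-∷ʳ : (w u : Vec ℕ n) (b a : ℕ) → (w ∷ʳ b) ⊞ (u ∷ʳ a) ≡ (w ⊞ u) ∷ʳ (b + a)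
⊞-∷ʳ []      []      b a = refl
⊞-∷ʳ (x ∷ w) (y ∷ u) b a = cong ((x + y) ∷_) (⊞-∷ʳ w u b a)

deg-∷ʳ : (α : Vec ℕ n) (s : ℕ) → deg (α ∷ʳ s) ≡ deg α + s
deg-∷ʳ []      s = +-identityʳ s
deg-∷ʳ (x ∷ α) s = trans (cong (x +_) (deg-∷ʳ α s)) (sym (+-assoc x _ s))

sumOver-box-suc : ∀ n b (F : Vec ℕ (suc n) → ℕ) →
  sumOver F (box (suc n) b) ≡ sumBelow (λ i → sumOver (λ α → F (i ∷ α)) (box n b)) (suc b)
sumOver-box-suc n b F =
  trans (sumOver-concatMap F (λ i → map (i ∷_) (box n b)) (upTo (suc b)))
        (sumOver-cong (λ i → sumOver-map F (i ∷_) (box n b)) (upTo (suc b)))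

sumOver-box-indicator : ∀ n b (γ : Vec ℕ n) → All (_≤ b) γ →
                        sumOver (λ α → if γ ≡ᵥ α then 1 else 0) (box n b) ≡ 1
sumOver-box-indicator zero    b []      []           = refl
sumOver-box-indicator (suc n) b (g ∷ γ) (g≤b ∷ γ≤b) = begin
  sumOver (λ α → if (g ∷ γ) ≡ᵥ α then 1 else 0) (box (suc n) b)
    ≡⟨ sumOver-box-suc n b _ ⟩
  sumBelow (λ i → sumOver (λ α → if (g ≡ᵇ i) ∧ (γ ≡ᵥ α) then 1 else 0) (box n b)) (suc b)
    ≡⟨ sumOver-cong inner (upTo (suc b)) ⟩
  sumBelow indicator (suc b)
    ≡⟨ sumBelow-single indicator g (λ i i≢g → cong (if_then 1 else 0) (≢⇒≡ᵇ≡false (≢-sym i≢g)))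
                       (suc b) (s≤s g≤b) ⟩
  indicator g
    ≡⟨ cong (if_then 1 else 0) (≡⇒≡ᵇ≡true {g} refl) ⟩
  1 ∎
  where
  open ≡-Reasoning
  indicator : ℕ → ℕ
  indicator i = if g ≡ᵇ i then 1 else 0
  inner : ∀ i → sumOver (λ α → if (g ≡ᵇ i) ∧ (γ ≡ᵥ α) then 1 else 0) (box n b) ≡ indicator i
  inner i with g ≡ᵇ i
  ... | true  = sumOver-box-indicator n b γ γ≤b
  ... | false = sumOver-zero (λ _ → refl) (box n b)

sumOver-box-shift : ∀ n (c : Vec ℕ n) b b′ (F : Vec ℕ n → ℕ) → All (λ cᵢ → cᵢ + b′ ≤ b) c →
  (∀ α → F α ≢ 0 → All (_≤ b′) α) →
  sumOver (λ α → if c ≤ᵥ α then F (α ⊟ c) else 0) (box n b) ≡ sumOver F (box n b′)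
sumOver-box-shift zero    []       b b′ F []              F-bounded = refl
sumOver-box-shift (suc n) (c₀ ∷ c) b b′ F (c₀+b′≤b ∷ c-fits) F-bounded = begin
  sumOver (λ α → if (c₀ ∷ c) ≤ᵥ α then F (α ⊟ (c₀ ∷ c)) else 0) (box (suc n) b)
    ≡⟨ sumOver-box-suc n b _ ⟩
  sumBelow (λ i → sumOver (λ α → if (c₀ ≤ᵇ i) ∧ (c ≤ᵥ α) then F ((i ∸ c₀) ∷ (α ⊟ c)) else 0)
                          (box n b)) (suc b)
    ≡⟨ sumOver-cong inner (upTo (suc b)) ⟩
  sumBelow (λ i → if c₀ ≤ᵇ i then H (i ∸ c₀) else 0) (suc b)
    ≡⟨ sumBelow-shift c₀ H (suc b) ⟩
  sumBelow H (suc b ∸ c₀)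
    ≡⟨ sumBelow-truncate H (suc b′) H-vanishes (suc b ∸ c₀) b′<b+1∸c₀ ⟩
  sumBelow H (suc b′)
    ≡⟨ sumOver-box-suc n b′ F ⟨
  sumOver F (box (suc n) b′) ∎
  where
  open ≡-Reasoning
  H : ℕ → ℕ
  H j = sumOver (λ α → F (j ∷ α)) (box n b′)
  inner : ∀ i → sumOver (λ α → if (c₀ ≤ᵇ i) ∧ (c ≤ᵥ α) then F ((i ∸ c₀) ∷ (α ⊟ c)) else 0) (box n b)
              ≡ (if c₀ ≤ᵇ i then H (i ∸ c₀) else 0)
  inner i with c₀ ≤ᵇ i
  ... | true  = sumOver-box-shift n c b b′ (λ α → F ((i ∸ c₀) ∷ α)) c-fits
                  (λ α F≢0 → All.tail (F-bounded _ F≢0))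
  ... | false = sumOver-zero (λ _ → refl) (box n b)
  H-vanishes : ∀ k → suc b′ ≤ k → H k ≡ 0
  H-vanishes k b′<k = sumOver-zero (λ α → ≢0⇒≡0 λ F≢0 →
    <⇒≱ b′<k (All.head (F-bounded (k ∷ α) F≢0))) (box n b′)
  b′<b+1∸c₀ : suc b′ ≤ suc b ∸ c₀
  b′<b+1∸c₀ = subst (suc b′ ≤_) (sym (+-∸-assoc 1 (≤-trans (m≤m+n c₀ b′) c₀+b′≤b)))
                    (s≤s (m+n≤o⇒m≤o∸n b′ (subst (_≤ b) (+-comm c₀ b′) c₀+b′≤b)))

-- F(1, …, 1, y) summed over the box {0, …, s}ⁿ as in hG₂, which gives the full coefficient
-- of y^s only for series that are BoundedByY.
specialise : Ser (suc n) → Ser 1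
specialise {n} f v = sumOver (λ α → f (α ∷ʳ V.head v)) (box n (V.head v))

BoundedByY : Ser (suc n) → Set
BoundedByY f = ∀ α s → f (α ∷ʳ s) ≢ 0 → All (_≤ s) α

All≤-·ᵥ⊞ : ∀ k {βy a} (βx u : Vec ℕ n) → All (_≤ βy) βx → All (_≤ a) u →
           All (_≤ k * βy + a) (k ·ᵥ βx ⊞ u)
All≤-·ᵥ⊞ k []       []      []            []          = []
All≤-·ᵥ⊞ k (x ∷ βx) (y ∷ u) (x≤βy ∷ βx≤) (y≤a ∷ u≤) =
  +-mono-≤ (*-monoʳ-≤ k x≤βy) y≤a ∷ All≤-·ᵥ⊞ k βx u βx≤ u≤

divOneMinus-boundedByY : ∀ (βx : Vec ℕ n) βy f → All (_≤ βy) βx → BoundedByY f →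
                       BoundedByY (divOneMinus (βx ∷ʳ βy) f)
divOneMinus-boundedByY βx βy f βx≤βy f-bounded α s ≢0
  with divOneMinus-nonzero (βx ∷ʳ βy) f (α ∷ʳ s) ≢0
... | k , m′ , eq , f≢0 with V.initLast m′
... | u , a , refl with Vecₚ.∷ʳ-injective α (k ·ᵥ βx ⊞ u)
        (trans eq (trans (cong (_⊞ (u ∷ʳ a)) (Vecₚ.map-∷ʳ (k *_) βy βx)) (⊞-∷ʳ (k ·ᵥ βx) u (k * βy) a)))
... | refl , refl = All≤-·ᵥ⊞ k βx u βx≤βy (f-bounded u a f≢0)

mono-boundedByY : ∀ (γx : Vec ℕ n) γy → All (_≤ γy) γx → BoundedByY (mono (γx ∷ʳ γy))
mono-boundedByY γx γy γx≤γy α s ≢0 with Vecₚ.∷ʳ-injective γx α (mono-nonzero (γx ∷ʳ γy) (α ∷ʳ s) ≢0)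
... | refl , refl = γx≤γy

specialise-cong : {f g : Ser (suc n)} → f ≋ g → specialise f ≋ specialise g
specialise-cong {n} f≋g v = sumOver-cong (λ α → f≋g (α ∷ʳ V.head v)) (box n (V.head v))

specialise-⊕ : (f g : Ser (suc n)) → specialise (f ⊕ g) ≋ specialise f ⊕ specialise g
specialise-⊕ {n} f g v = sumOver-+ (λ α → f (α ∷ʳ V.head v)) (λ α → g (α ∷ʳ V.head v)) (box n (V.head v))

specialise-mono : ∀ (γx : Vec ℕ n) γy → All (_≤ γy) γx → specialise (mono (γx ∷ʳ γy)) ≋ mono (γy ∷ [])
specialise-mono {n} γx γy γx≤γy (s ∷ []) =
  trans (sumOver-cong (λ α → cong (if_then 1 else 0) (≡ᵥ-∷ʳ γx α γy s)) (box n s)) (count (γy ≡ᵇ s) refl)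
  where
  count : ∀ b → (γy ≡ᵇ s) ≡ b →
          sumOver (λ α → if (γx ≡ᵥ α) ∧ b then 1 else 0) (box n s) ≡ (if b ∧ true then 1 else 0)
  count false _ = sumOver-zero (λ α → cong (if_then 1 else 0) (∧-zeroʳ (γx ≡ᵥ α))) (box n s)
  count true γy≡ᵇs with ≡ᵇ≡true⇒≡ γy s γy≡ᵇs
  ... | refl = trans (sumOver-cong (λ α → cong (if_then 1 else 0) (∧-identityʳ (γx ≡ᵥ α))) (box n s))
                     (sumOver-box-indicator n γy γx γx≤γy)

-- After exchanging the sums over α and k, the k-th inner sum is the box sum of f at level
-- s − k βy, shifted by k βx.
specialise-divOneMinus : ∀ (βx : Vec ℕ n) βy f → 1 ≤ βy → All (_≤ βy) βx → BoundedByY f →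
                         specialise (divOneMinus (βx ∷ʳ βy) f) ≋ divOneMinus (βy ∷ []) (specialise f)
specialise-divOneMinus {n} βx βy f 1≤βy βx≤βy f-bounded (s ∷ []) = begin
  sumOver (λ α → divOneMinus (βx ∷ʳ βy) f (α ∷ʳ s)) (box n s)
    ≡⟨ sumOver-cong coeff (box n s) ⟩
  sumOver (λ α → sumBelow (term α) (suc s)) (box n s)
    ≡⟨ sumOver-sumBelow-comm term (box n s) (suc s) ⟩
  sumBelow (λ k → sumOver (λ α → term α k) (box n s)) (suc s)
    ≡⟨ sumOver-cong specialised-term (upTo (suc s)) ⟩
  sumBelow (geometricTerm (βy ∷ []) (specialise f) (s ∷ [])) (suc s)
    ≡⟨ cong (λ N → sumBelow (geometricTerm (βy ∷ []) (specialise f) (s ∷ [])) (suc N)) (+-identityʳ s) ⟨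
  divOneMinus (βy ∷ []) (specialise f) (s ∷ []) ∎
  where
  open ≡-Reasoning
  term : Vec ℕ n → ℕ → ℕ
  term α k = if ((k ·ᵥ βx) ≤ᵥ α) ∧ (k * βy ≤ᵇ s) then f ((α ⊟ k ·ᵥ βx) ∷ʳ (s ∸ k * βy)) else 0
  geometricTerm≡term : ∀ α k → geometricTerm (βx ∷ʳ βy) f (α ∷ʳ s) k ≡ term α k
  geometricTerm≡term α k rewrite Vecₚ.map-∷ʳ (k *_) βy βx | ≤ᵥ-∷ʳ (k ·ᵥ βx) α (k * βy) s
    | ⊟-∷ʳ α (k ·ᵥ βx) s (k * βy) = refl
  term-vanishes : ∀ α k → suc s ≤ k → term α k ≡ 0
  term-vanishes α k s<k = cong (if_then f ((α ⊟ k ·ᵥ βx) ∷ʳ (s ∸ k * βy)) else 0)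
    (trans (cong (((k ·ᵥ βx) ≤ᵥ α) ∧_) (≰⇒≤ᵇ≡false kβy≰s)) (∧-zeroʳ ((k ·ᵥ βx) ≤ᵥ α)))
    where
    kβy≰s : ¬ k * βy ≤ s
    kβy≰s kβy≤s = <⇒≱ s<k (≤-trans (m≤m*n k βy {{>-nonZero 1≤βy}}) kβy≤s)
  coeff : ∀ α → divOneMinus (βx ∷ʳ βy) f (α ∷ʳ s) ≡ sumBelow (term α) (suc s)
  coeff α = trans (sumOver-cong (geometricTerm≡term α) (upTo (suc (deg (α ∷ʳ s)))))
    (sumBelow-truncate (term α) (suc s) (term-vanishes α) (suc (deg (α ∷ʳ s)))
      (s≤s (subst (s ≤_) (sym (deg-∷ʳ α s)) (m≤n+m s (deg α)))))
  specialised-term : ∀ k → sumOver (λ α → term α k) (box n s)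
                         ≡ geometricTerm (βy ∷ []) (specialise f) (s ∷ []) k
  specialised-term k with k * βy ≤ᵇ s in kβy≤ᵇs
  ... | false = sumOver-zero (λ α → cong (if_then f ((α ⊟ k ·ᵥ βx) ∷ʳ (s ∸ k * βy)) else 0)
                                       (∧-zeroʳ ((k ·ᵥ βx) ≤ᵥ α))) (box n s)
  ... | true  = trans (sumOver-cong (λ α → cong (if_then f ((α ⊟ k ·ᵥ βx) ∷ʳ (s ∸ k * βy)) else 0)
                                              (∧-identityʳ ((k ·ᵥ βx) ≤ᵥ α))) (box n s))
      (sumOver-box-shift n (k ·ᵥ βx) s (s ∸ k * βy) (λ α → f (α ∷ʳ (s ∸ k * βy))) fits
        (λ α f≢0 → f-bounded α (s ∸ k * βy) f≢0))
    where
    fits : All (λ cᵢ → cᵢ + (s ∸ k * βy) ≤ s) (k ·ᵥ βx)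
    fits = map⁺ (All.map (λ xᵢ≤βy → ≤-trans (+-monoˡ-≤ (s ∸ k * βy) (*-monoʳ-≤ k xᵢ≤βy))
                                       (≤-reflexive (m+[n∸m]≡n (≤ᵇ≡true⇒≤ (k * βy) s kβy≤ᵇs)))) βx≤βy)

Specialisable : Vec ℕ n × ℕ → Set
Specialisable (βx , βy) = 1 ≤ βy × All (_≤ βy) βx

specialisable? : (β : Vec ℕ n × ℕ) → Dec (Specialisable β)
specialisable? (βx , βy) = (1 ≤? βy) ×-dec all? (_≤? βy) βx

divOneMinusAll : List (Vec ℕ n × ℕ) → Ser (suc n) → Ser (suc n)
divOneMinusAll βs f = foldr (λ (βx , βy) → divOneMinus (βx ∷ʳ βy)) f βs

divOneMinusAll-boundedByY : ∀ βs {f : Ser (suc n)} → ListAll.All Specialisable βs → BoundedByY f →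
                          BoundedByY (divOneMinusAll βs f)
divOneMinusAll-boundedByY []               ListAll.[]            f-bounded = f-bounded
divOneMinusAll-boundedByY ((βx , βy) ∷ βs) {f} ((_ , βx≤βy) ListAll.∷ specialisable) f-bounded =
  divOneMinus-boundedByY βx βy (divOneMinusAll βs f) βx≤βy
    (divOneMinusAll-boundedByY βs specialisable f-bounded)

specialise-divOneMinusAll : ∀ βs (f : Ser (suc n)) {g} → ListAll.All Specialisable βs → BoundedByY f →
  specialise f ≋ g → specialise (divOneMinusAll βs f) ≋ foldr (λ (_ , βy) → divOneMinus (βy ∷ [])) g βs
specialise-divOneMinusAll []               f ListAll.[]            f-bounded f≋g = f≋g
specialise-divOneMinusAll ((βx , βy) ∷ βs) f ((1≤βy , βx≤βy) ListAll.∷ specialisable) f-bounded f≋g v =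
  trans (specialise-divOneMinus βx βy (divOneMinusAll βs f) 1≤βy βx≤βy
           (divOneMinusAll-boundedByY βs specialisable f-bounded) v)
        (divOneMinus-cong (βy ∷ []) (specialise-divOneMinusAll βs f specialisable f-bounded f≋g) v)

-- The univariate identity 1/(1 − y) = (1 + y)/(1 − y²)

coeff-1/[1-y] : ∀ s → divOneMinus y¹ one (s ∷ []) ≡ 1
coeff-1/[1-y] s =
  subst (λ m → divOneMinus y¹ one m ≡ 1) (cong (_∷ []) (trans (+-identityʳ (s * 1)) (*-identityʳ s)))
        (divOneMinus-coeff≡1 y¹ one s (0 ∷ []) refl (mono-supportedOn (0 ∷ []) zero) refl)

-- With s = r + 2q and r < 2 only the term k = q of the expansion survives.
coeff-[1+y]/[1-y²] : ∀ s → divOneMinus y² (one ⊕ mono y¹) (s ∷ []) ≡ 1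
coeff-[1+y]/[1-y²] s with s / 2 | s % 2 | m≡m%n+[m/n]*n s 2 | m%n<n s 2
... | q | r | refl | r<2 =
  trans (sumBelow-single (geometricTerm y² 1+y (r + q * 2 ∷ [])) q others (suc (r + q * 2 + 0)) q<) term-q
  where
  1+y : Ser 1
  1+y = one ⊕ mono y¹
  1+y-below-2 : ∀ {x} → x < 2 → 1+y (x ∷ []) ≡ 1
  1+y-below-2 (s≤s z≤n)       = refl
  1+y-below-2 (s≤s (s≤s z≤n)) = refl
  1+y-from-2 : ∀ {x} → 2 ≤ x → 1+y (x ∷ []) ≡ 0
  1+y-from-2 (s≤s (s≤s _)) = refl
  q< : q < suc (r + q * 2 + 0)
  q< = s≤s (≤-trans (≤-trans (m≤m*n q 2) (m≤n+m (q * 2) r)) (m≤m+n _ 0))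
  term-q : geometricTerm y² 1+y (r + q * 2 ∷ []) q ≡ 1
  term-q rewrite ≤⇒≤ᵇ≡true (m≤n+m (q * 2) r) | m+n∸n≡m r (q * 2) = 1+y-below-2 r<2
  others : ∀ k → k ≢ q → geometricTerm y² 1+y (r + q * 2 ∷ []) k ≡ 0
  others k k≢q with k * 2 ≤ᵇ r + q * 2 in k2≤ᵇ
  ... | false = refl
  ... | true with <-cmp k q
  ...   | tri≈ _ k≡q _ = ⊥-elim (k≢q k≡q)
  ...   | tri< k<q _ _ = 1+y-from-2 (m+n≤o⇒m≤o∸n 2 (≤-trans (*-monoˡ-≤ 2 k<q) (m≤n+m (q * 2) r)))
  ...   | tri> _ _ q<k = ⊥-elim (<⇒≱ r<2 (+-cancelʳ-≤ (q * 2) 2 r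
                           (≤-trans (*-monoˡ-≤ 2 q<k) (≤ᵇ≡true⇒≤ (k * 2) (r + q * 2) k2≤ᵇ))))

1/[1-y]≋[1+y]/[1-y²] : divOneMinus y¹ one ≋ divOneMinus y² (one ⊕ mono y¹)
1/[1-y]≋[1+y]/[1-y²] (s ∷ []) = trans (coeff-1/[1-y] s) (sym (coeff-[1+y]/[1-y²] s))

over[1-y]³ : Ser 1 → Ser 1
over[1-y]³ f = divOneMinus y¹ (divOneMinus y¹ (divOneMinus y¹ f))

over[1-y]³-cong : {f g : Ser 1} → f ≋ g → over[1-y]³ f ≋ over[1-y]³ g
over[1-y]³-cong f≋g = divOneMinus-cong y¹ (divOneMinus-cong y¹ (divOneMinus-cong y¹ f≋g))

over[1-y]³-⊕ : (f g : Ser 1) → over[1-y]³ (f ⊕ g) ≋ over[1-y]³ f ⊕ over[1-y]³ g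
over[1-y]³-⊕ f g = begin
  over[1-y]³ (f ⊕ g)
    ≈⟨ divOneMinus-cong y¹ (divOneMinus-cong y¹ (divOneMinus-⊕ y¹ f g)) ⟩
  divOneMinus y¹ (divOneMinus y¹ (divOneMinus y¹ f ⊕ divOneMinus y¹ g))
    ≈⟨ divOneMinus-cong y¹ (divOneMinus-⊕ y¹ (divOneMinus y¹ f) (divOneMinus y¹ g)) ⟩
  divOneMinus y¹ (divOneMinus y¹ (divOneMinus y¹ f) ⊕ divOneMinus y¹ (divOneMinus y¹ g))
    ≈⟨ divOneMinus-⊕ y¹ (divOneMinus y¹ (divOneMinus y¹ f)) (divOneMinus y¹ (divOneMinus y¹ g)) ⟩
  over[1-y]³ f ⊕ over[1-y]³ g ∎
  where open SetoidReasoning (≋-setoid 1)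

generators₁ generators₂ : List (Vec ℕ 9 × ℕ)
generators₁ = (init m158 , 1) ∷ (init m269 , 1) ∷ (init m347 , 1) ∷ (init m789 , 1) ∷ []
generators₂ = (init m158 , 1) ∷ (init m269 , 1) ∷ (init m347 , 1) ∷ (init m123456 , 2) ∷ []

specialise-summand₁ : specialise summand₁ ≋ over[1-y]³ (divOneMinus y¹ one)
specialise-summand₁ =
  specialise-divOneMinusAll generators₁ one
    (toWitness {a? = ListAll.all? specialisable? generators₁} _)
    (mono-boundedByY (replicate 9 0) 0 zeros≤0) (specialise-mono (replicate 9 0) 0 zeros≤0)
  where
  zeros≤0 : All (_≤ 0) (replicate 9 0)
  zeros≤0 = toWitness {a? = all? (_≤? 0) (replicate 9 0)} _

specialise-summand₂ : specialise summand₂ ≋ over[1-y]³ (divOneMinus y² (mono y²))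
specialise-summand₂ =
  specialise-divOneMinusAll generators₂ (mono m123456)
    (toWitness {a? = ListAll.all? specialisable? generators₂} _)
    (mono-boundedByY (init m123456) 2 x≤2) (specialise-mono (init m123456) 2 x≤2)
  where
  x≤2 : All (_≤ 2) (init m123456)
  x≤2 = toWitness {a? = all? (_≤? 2) (init m123456)} _

mainTheorem4 :
    (FG₂ ≋ divOneMinus m158 (divOneMinus m269 (divOneMinus m347 (divOneMinus m789 one)))
         ⊕ divOneMinus m158 (divOneMinus m269 (divOneMinus m347 (divOneMinus m123456 (mono m123456)))))
    × (FG₂y ≋ divOneMinus y¹ (divOneMinus y¹ (divOneMinus y¹ (divOneMinus y² (one ⊕ mono y¹ ⊕ mono y²)))))
mainTheorem4 = FG₂≋summands , (begin
  FG₂y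
    ≈⟨ specialise-cong FG₂≋summands ⟩
  specialise (summand₁ ⊕ summand₂)
    ≈⟨ specialise-⊕ summand₁ summand₂ ⟩
  specialise summand₁ ⊕ specialise summand₂
    ≈⟨ ⊕-cong specialise-summand₁ specialise-summand₂ ⟩
  over[1-y]³ (divOneMinus y¹ one) ⊕ over[1-y]³ (divOneMinus y² (mono y²))
    ≈⟨ ⊕-cong (over[1-y]³-cong 1/[1-y]≋[1+y]/[1-y²]) (λ _ → refl) ⟩
  over[1-y]³ (divOneMinus y² (one ⊕ mono y¹)) ⊕ over[1-y]³ (divOneMinus y² (mono y²))
    ≈⟨ over[1-y]³-⊕ (divOneMinus y² (one ⊕ mono y¹)) (divOneMinus y² (mono y²)) ⟨
  over[1-y]³ (divOneMinus y² (one ⊕ mono y¹) ⊕ divOneMinus y² (mono y²))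
    ≈⟨ over[1-y]³-cong (divOneMinus-⊕ y² (one ⊕ mono y¹) (mono y²)) ⟨
  over[1-y]³ (divOneMinus y² (one ⊕ mono y¹ ⊕ mono y²)) ∎)
  where open SetoidReasoning (≋-setoid 1)
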